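{- Let $T\subseteq\mathbb{F}_2^n$ and define $T+\star\subseteq\mathbb{F}_2^{n+1}$ by \[T+\star:=\{\mathbf{v}0\mid \mathbf{v}\in T\}\cup\{\mathbf{v}1\mid \mathbf{v}\in\mathbb{F}_2^n\setminus T\},\] where $\mathbf{v}a$ denotes $\mathbf{v}$ with the bit $a$ appended. Then $T$ is a powerful set if and only if $T+\star$ is a powerful set.
   Context: A set $S\subseteq\mathbb{F}_2^n$ (positions indexed by $[n]=\{1,\dots,n\}$) is called a powerful set if for every $X\subseteq[n]$ the number of vectors in $S$ whose coordinates in all positions of $X$ are zero is a power of $2$. -}

module Defs where

open import Data.Bool using (Bool; true; false; not; if_then_else_; _∧_)
open import Data.Nat using (ℕ; zero; suc; _+_; _^_)
open import Data.List using (List; []; _∷_; map; _++_; length; filter)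
open import Data.Vec using (Vec; []; _∷_; init; last; lookup; _∷ʳ_)
open import Data.Fin using (Fin)
open import Data.Fin.Subset using (Subset; _∈_)
open import Data.Product using (∃)
open import Relation.Binary.PropositionalEquality using (_≡_)
open import Relation.Nullary using (Dec; yes; no)
open import Data.Bool using (T)
open import Relation.Nullary.Decidable using (does)

-- Vectors of F₂ⁿ: bit vectors (false = 0, true = 1).
F₂^ : ℕ → Set
F₂^ n = Vec Bool n

-- A subset of F₂ⁿ, given by its (decidable) characteristic function;
-- since F₂ⁿ is finite this is the same as an arbitrary subset.
SubsetF₂ : ℕ → Set
SubsetF₂ n = F₂^ n → Bool

allVecs : (n : ℕ) → List (F₂^ n)
allVecs zero = [] ∷ []
allVecs (suc n) = map (false ∷_) (allVecs n) ++ map (true ∷_) (allVecs n)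

zeroOn : ∀ {n} → Subset n → F₂^ n → Bool
zeroOn [] [] = true
zeroOn (true ∷ X) (b ∷ v) = not b ∧ zeroOn X v
zeroOn (false ∷ X) (b ∷ v) = zeroOn X v

count : ∀ {n} → SubsetF₂ n → Subset n → ℕ
count {n} S X = length (filter (λ v → T? (S v ∧ zeroOn X v)) (allVecs n))
  where
  T? : (b : Bool) → Dec (T b)
  T? true = yes _
  T? false = no λ ()

IsPowerOf2 : ℕ → Set
IsPowerOf2 m = ∃ λ k → m ≡ 2 ^ k

Powerful : ∀ {n} → SubsetF₂ n → Set
Powerful {n} S = (X : Subset n) → IsPowerOf2 (count S X)

_+⋆ : ∀ {n} → SubsetF₂ n → SubsetF₂ (suc n)
(S +⋆) w = if last w then not (S (init w)) else S (init w)

-- Splitting F₂ⁿ⁺¹ by the last bit, the vectors of T + ⋆ vanishing on X ∷ʳ 1 are exactly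
-- the vectors v0 with v ∈ T vanishing on X, so they are counted by count T X.  The vectors
-- vanishing on X ∷ʳ 0 are those v0 with v ∈ T and v1 with v ∉ T vanishing on X; together
-- they are as many as the vectors of F₂ⁿ vanishing on X, i.e. 2^(n - |X|).  Hence T + ⋆ is
-- powerful on the sets X ∷ʳ 0 unconditionally and on the sets X ∷ʳ 1 exactly when T is.
module Submission where

open import Defs
open import Data.Bool using (Bool; true; false; not; if_then_else_; _∧_; T)
open import Data.Bool.Properties using (∧-assoc; ∧-identityʳ; ∧-zeroʳ)
open import Data.Nat using (ℕ; zero; suc; _+_; _^_)
open import Data.Nat.Properties using (+-suc; +-identityʳ; +-commutativeSemigroup)
open import Algebra.Properties.CommutativeSemigroup +-commutativeSemigroup using (interchange)
open import Data.List using (List; []; _∷_; map; _++_; length; filter)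
open import Data.Vec using ([]; _∷_; _∷ʳ_; initLast)
open import Data.Vec.Properties using (init-∷ʳ; last-∷ʳ)
open import Data.Fin.Subset using (Subset; ∁; ∣_∣)
open import Data.Product using (_,_)
open import Function.Bundles using (_⇔_; mk⇔)
open import Relation.Binary.PropositionalEquality
open import Relation.Nullary using (Dec; yes; no; contradiction)

countᵇ : {A : Set} → (A → Bool) → List A → ℕ
countᵇ p [] = 0
countᵇ p (x ∷ xs) = if p x then suc (countᵇ p xs) else countᵇ p xs

length-filter≡countᵇ : {A : Set} (p : A → Bool) (p? : ∀ x → Dec (T (p x))) (xs : List A) →
                       length (filter p? xs) ≡ countᵇ p xs
length-filter≡countᵇ p p? [] = refl
length-filter≡countᵇ p p? (x ∷ xs) with p x | p? x
... | true  | yes _     = cong suc (length-filter≡countᵇ p p? xs)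
... | true  | no ¬true = contradiction _ ¬true
... | false | no _      = length-filter≡countᵇ p p? xs

countᵇ-cong : {A : Set} {p q : A → Bool} → (∀ x → p x ≡ q x) → ∀ xs → countᵇ p xs ≡ countᵇ q xs
countᵇ-cong p≗q [] = refl
countᵇ-cong p≗q (x ∷ xs) rewrite p≗q x | countᵇ-cong p≗q xs = refl

countᵇ-++ : {A : Set} (p : A → Bool) (xs ys : List A) →
            countᵇ p (xs ++ ys) ≡ countᵇ p xs + countᵇ p ys
countᵇ-++ p [] ys = refl
countᵇ-++ p (x ∷ xs) ys with p x
... | true  = cong suc (countᵇ-++ p xs ys)
... | false = countᵇ-++ p xs ys

countᵇ-map : {A B : Set} (p : B → Bool) (f : A → B) (xs : List A) →
             countᵇ p (map f xs) ≡ countᵇ (λ x → p (f x)) xs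
countᵇ-map p f [] = refl
countᵇ-map p f (x ∷ xs) with p (f x)
... | true  = cong suc (countᵇ-map p f xs)
... | false = countᵇ-map p f xs

countᵇ-false : {A : Set} (xs : List A) → countᵇ (λ _ → false) xs ≡ 0
countᵇ-false [] = refl
countᵇ-false (x ∷ xs) = countᵇ-false xs

countᵇ-partition : {A : Set} (p q : A → Bool) (xs : List A) →
                   countᵇ (λ x → p x ∧ q x) xs + countᵇ (λ x → not (p x) ∧ q x) xs ≡ countᵇ q xs
countᵇ-partition p q [] = refl
countᵇ-partition p q (x ∷ xs) with p x | q x
... | true  | true  = cong suc (countᵇ-partition p q xs)
... | true  | false = countᵇ-partition p q xs
... | false | true  = trans (+-suc _ _) (cong suc (countᵇ-partition p q xs))
... | false | false = countᵇ-partition p q xs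

countAll : ∀ {n} → (F₂^ n → Bool) → ℕ
countAll {n} p = countᵇ p (allVecs n)

count≡countAll : ∀ {n} (S : SubsetF₂ n) (X : Subset n) → count S X ≡ countAll (λ v → S v ∧ zeroOn X v)
count≡countAll {n} S X = length-filter≡countᵇ (λ v → S v ∧ zeroOn X v) _ (allVecs n)

countAll-cong : ∀ {n} {p q : F₂^ n → Bool} → (∀ v → p v ≡ q v) → countAll p ≡ countAll q
countAll-cong {n} p≗q = countᵇ-cong p≗q (allVecs n)

countAll-∷ : ∀ n (p : F₂^ (suc n) → Bool) →
             countAll p ≡ countAll (λ v → p (false ∷ v)) + countAll (λ v → p (true ∷ v))
countAll-∷ n p = begin
  countᵇ p (map (false ∷_) (allVecs n) ++ map (true ∷_) (allVecs n))
    ≡⟨ countᵇ-++ p (map (false ∷_) (allVecs n)) (map (true ∷_) (allVecs n)) ⟩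
  countᵇ p (map (false ∷_) (allVecs n)) + countᵇ p (map (true ∷_) (allVecs n))
    ≡⟨ cong₂ _+_ (countᵇ-map p (false ∷_) (allVecs n)) (countᵇ-map p (true ∷_) (allVecs n)) ⟩
  countAll (λ v → p (false ∷ v)) + countAll (λ v → p (true ∷ v)) ∎
  where open ≡-Reasoning

countAll-∷ʳ : ∀ n (p : F₂^ (suc n) → Bool) →
              countAll p ≡ countAll (λ v → p (v ∷ʳ false)) + countAll (λ v → p (v ∷ʳ true))
countAll-∷ʳ zero p = countAll-∷ zero p
countAll-∷ʳ (suc n) p = begin
  countAll p
    ≡⟨ countAll-∷ (suc n) p ⟩
  countAll (λ v → p (false ∷ v)) + countAll (λ v → p (true ∷ v))
    ≡⟨ cong₂ _+_ (countAll-∷ʳ n (λ v → p (false ∷ v))) (countAll-∷ʳ n (λ v → p (true ∷ v))) ⟩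
  (c false false + c false true) + (c true false + c true true)
    ≡⟨ interchange (c false false) (c false true) (c true false) (c true true) ⟩
  (c false false + c true false) + (c false true + c true true)
    ≡⟨ sym (cong₂ _+_ (countAll-∷ n (λ v → p (v ∷ʳ false))) (countAll-∷ n (λ v → p (v ∷ʳ true)))) ⟩
  countAll (λ v → p (v ∷ʳ false)) + countAll (λ v → p (v ∷ʳ true)) ∎
  where
  open ≡-Reasoning
  c : Bool → Bool → ℕ
  c first lst = countAll (λ v → p ((first ∷ v) ∷ʳ lst))

countAll-zeroOn : ∀ {n} (X : Subset n) → countAll (zeroOn X) ≡ 2 ^ ∣ ∁ X ∣
countAll-zeroOn [] = refl
countAll-zeroOn {suc n} (true ∷ X) = begin
  countAll (zeroOn (true ∷ X))                     ≡⟨ countAll-∷ n (zeroOn (true ∷ X)) ⟩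
  countAll (zeroOn X) + countAll {n} (λ _ → false) ≡⟨ cong₂ _+_ (countAll-zeroOn X) (countᵇ-false (allVecs n)) ⟩
  2 ^ ∣ ∁ X ∣ + 0                                  ≡⟨ +-identityʳ _ ⟩
  2 ^ ∣ ∁ X ∣                                      ∎
  where open ≡-Reasoning
countAll-zeroOn {suc n} (false ∷ X) = begin
  countAll (zeroOn (false ∷ X))             ≡⟨ countAll-∷ n (zeroOn (false ∷ X)) ⟩
  countAll (zeroOn X) + countAll (zeroOn X) ≡⟨ cong (λ m → m + m) (countAll-zeroOn X) ⟩
  2 ^ ∣ ∁ X ∣ + 2 ^ ∣ ∁ X ∣                  ≡⟨ cong (2 ^ ∣ ∁ X ∣ +_) (sym (+-identityʳ _)) ⟩
  2 ^ suc ∣ ∁ X ∣ ∎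
  where open ≡-Reasoning

full-powerful : ∀ {n} → Powerful {n} (λ _ → true)
full-powerful X = ∣ ∁ X ∣ , trans (count≡countAll (λ _ → true) X) (countAll-zeroOn X)

zeroOn-∷ʳ : ∀ {n} (X : Subset n) (b a : Bool) (v : F₂^ n) →
            zeroOn (X ∷ʳ b) (v ∷ʳ a) ≡ zeroOn X v ∧ not (b ∧ a)
zeroOn-∷ʳ [] true a [] = ∧-identityʳ (not a)
zeroOn-∷ʳ [] false a [] = refl
zeroOn-∷ʳ (true ∷ X) b a (c ∷ v) =
  trans (cong (not c ∧_) (zeroOn-∷ʳ X b a v)) (sym (∧-assoc (not c) (zeroOn X v) _))
zeroOn-∷ʳ (false ∷ X) b a (c ∷ v) = zeroOn-∷ʳ X b a v

+⋆-∷ʳ : ∀ {n} (S : SubsetF₂ n) (v : F₂^ n) (a : Bool) →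
        (S +⋆) (v ∷ʳ a) ≡ (if a then not (S v) else S v)
+⋆-∷ʳ S v a rewrite last-∷ʳ a v | init-∷ʳ a v = refl

count-+⋆-∷ʳ : ∀ {n} (S : SubsetF₂ n) (X : Subset n) (b : Bool) →
              count (S +⋆) (X ∷ʳ b) ≡
              countAll (λ v → S v ∧ zeroOn X v) + countAll (λ v → not (S v) ∧ (zeroOn X v ∧ not b))
count-+⋆-∷ʳ {n} S X b = begin
  count (S +⋆) (X ∷ʳ b)
    ≡⟨ count≡countAll (S +⋆) (X ∷ʳ b) ⟩
  countAll (λ w → (S +⋆) w ∧ zeroOn (X ∷ʳ b) w)
    ≡⟨ countAll-∷ʳ n _ ⟩
  countAll (λ v → (S +⋆) (v ∷ʳ false) ∧ zeroOn (X ∷ʳ b) (v ∷ʳ false))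
    + countAll (λ v → (S +⋆) (v ∷ʳ true) ∧ zeroOn (X ∷ʳ b) (v ∷ʳ true))
    ≡⟨ cong₂ _+_ (countAll-cong last-bit-0) (countAll-cong last-bit-1) ⟩
  countAll (λ v → S v ∧ zeroOn X v) + countAll (λ v → not (S v) ∧ (zeroOn X v ∧ not b)) ∎
  where
  open ≡-Reasoning
  last-bit-0 : ∀ v → (S +⋆) (v ∷ʳ false) ∧ zeroOn (X ∷ʳ b) (v ∷ʳ false) ≡ S v ∧ zeroOn X v
  last-bit-0 v rewrite +⋆-∷ʳ S v false | zeroOn-∷ʳ X b false v | ∧-zeroʳ b
    = cong (S v ∧_) (∧-identityʳ (zeroOn X v))
  last-bit-1 : ∀ v → (S +⋆) (v ∷ʳ true) ∧ zeroOn (X ∷ʳ b) (v ∷ʳ true) ≡ not (S v) ∧ (zeroOn X v ∧ not b)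
  last-bit-1 v rewrite +⋆-∷ʳ S v true | zeroOn-∷ʳ X b true v | ∧-identityʳ b = refl

count-+⋆-∷ʳ-true : ∀ {n} (S : SubsetF₂ n) (X : Subset n) → count (S +⋆) (X ∷ʳ true) ≡ count S X
count-+⋆-∷ʳ-true {n} S X = begin
  count (S +⋆) (X ∷ʳ true)
    ≡⟨ count-+⋆-∷ʳ S X true ⟩
  countAll (λ v → S v ∧ zeroOn X v) + countAll (λ v → not (S v) ∧ (zeroOn X v ∧ false))
    ≡⟨ cong (countAll (λ v → S v ∧ zeroOn X v) +_) complement-part-empty ⟩
  countAll (λ v → S v ∧ zeroOn X v) + 0
    ≡⟨ +-identityʳ _ ⟩
  countAll (λ v → S v ∧ zeroOn X v)
    ≡⟨ count≡countAll S X ⟨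
  count S X ∎
  where
  open ≡-Reasoning
  complement-part-empty : countAll (λ v → not (S v) ∧ (zeroOn X v ∧ false)) ≡ 0
  complement-part-empty = trans (countAll-cong (λ v → trans (cong (not (S v) ∧_) (∧-zeroʳ (zeroOn X v)))
                                                       (∧-zeroʳ (not (S v)))))
                           (countᵇ-false (allVecs n))

count-+⋆-∷ʳ-false : ∀ {n} (S : SubsetF₂ n) (X : Subset n) →
                    count (S +⋆) (X ∷ʳ false) ≡ count (λ _ → true) X
count-+⋆-∷ʳ-false {n} S X = begin
  count (S +⋆) (X ∷ʳ false)
    ≡⟨ count-+⋆-∷ʳ S X false ⟩
  countAll (λ v → S v ∧ zeroOn X v) + countAll (λ v → not (S v) ∧ (zeroOn X v ∧ true))
    ≡⟨ cong (countAll (λ v → S v ∧ zeroOn X v) +_)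
            (countAll-cong (λ v → cong (not (S v) ∧_) (∧-identityʳ (zeroOn X v)))) ⟩
  countAll (λ v → S v ∧ zeroOn X v) + countAll (λ v → not (S v) ∧ zeroOn X v)
    ≡⟨ countᵇ-partition S (zeroOn X) (allVecs n) ⟩
  countAll (zeroOn X)
    ≡⟨ count≡countAll (λ _ → true) X ⟨
  count (λ _ → true) X ∎
  where open ≡-Reasoning

theorem6 : (n : ℕ) (T : SubsetF₂ n) → Powerful T ⇔ Powerful (T +⋆)
theorem6 n S = mk⇔ to from
  where
  to : Powerful S → Powerful (S +⋆)
  to S-powerful X′ with initLast X′
  ... | X , true  , refl = subst IsPowerOf2 (sym (count-+⋆-∷ʳ-true S X)) (S-powerful X)
  ... | X , false , refl = subst IsPowerOf2 (sym (count-+⋆-∷ʳ-false S X)) (full-powerful X)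
  from : Powerful (S +⋆) → Powerful S
  from S⋆-powerful X = subst IsPowerOf2 (count-+⋆-∷ʳ-true S X) (S⋆-powerful (X ∷ʳ true))
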